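{- Let $H=(V,E)$ be a graph, let $t\ge 1$, and let $E_1,E_2,\ldots,E_s\subseteq E$ be sets of edges each containing at most $t$ edges. Suppose that for every $1\le i<j\le s$ the graph $H-(E_i\cup E_j)$ is disconnected. If $s>(2^t+1)2^{t-1}$, then $m(H)\le 2^t$.
   Context: All graphs are finite and simple. The symmetric difference of two graphs $G_1=(V,E_1)$, $G_2=(V,E_2)$ on the same vertex set is the graph $(V,E_1\oplus E_2)$, where $E_1\oplus E_2$ is the set of edges belonging to exactly one of $E_1,E_2$. For a graph $H$, a connectivity code for $H$ is a collection $\mathcal G$ of spanning subgraphs of $H$ such that the symmetric difference of any two distinct members of $\mathcal G$ is a connected spanning subgraph of $H$. $m(H)$ denotes the maximum possible cardinality of a connectivity code for $H$. -}

module Defs where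

open import Data.Nat using (ℕ; zero; suc; _+_; _<_)
open import Data.Bool using (Bool; true; false; _∧_; _∨_; not; _xor_; T)
open import Data.Fin using (Fin; toℕ)
open import Data.List using (List; map; allFin)
open import Data.Nat.ListAction using (sum)
open import Relation.Binary.PropositionalEquality using (_≡_)
open import Relation.Nullary using (¬_)
open import Relation.Nullary.Decidable using (⌊_⌋)
open import Data.Nat using (_<?_)

Adj : ℕ → Set
Adj n = Fin n → Fin n → Bool

record SimpleGraph (n : ℕ) : Set where
  field
    adj    : Adj n
    sym    : ∀ u v → adj u v ≡ adj v u
    irrefl : ∀ u → adj u u ≡ false
open SimpleGraph public

_⊆ᴱ_ : ∀ {n} → SimpleGraph n → SimpleGraph n → Set
G ⊆ᴱ H = ∀ u v → T (adj G u v) → T (adj H u v)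

SameEdges : ∀ {n} → SimpleGraph n → SimpleGraph n → Set
SameEdges G H = ∀ u v → adj G u v ≡ adj H u v

edgeCount : ∀ {n} → SimpleGraph n → ℕ
edgeCount {n} G =
  sum (map (λ u → sum (map (λ v → b2n (⌊ toℕ u <? toℕ v ⌋ ∧ adj G u v)) (allFin n))) (allFin n))
  where
  b2n : Bool → ℕ
  b2n true  = 1
  b2n false = 0

data Reach {n : ℕ} (A : Adj n) : Fin n → Fin n → Set where
  here : ∀ {u} → Reach A u u
  step : ∀ {u v w} → T (A u v) → Reach A v w → Reach A u w

Connected : ∀ {n} → Adj n → Set
Connected {n} A = ∀ (u v : Fin n) → Reach A u v

symDiff : ∀ {n} → SimpleGraph n → SimpleGraph n → Adj n
symDiff G₁ G₂ u v = adj G₁ u v xor adj G₂ u v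

minusUnion : ∀ {n} → SimpleGraph n → SimpleGraph n → SimpleGraph n → Adj n
minusUnion H E₁ E₂ u v = adj H u v ∧ not (adj E₁ u v ∨ adj E₂ u v)

record ConnectivityCode {n : ℕ} (H : SimpleGraph n) (k : ℕ) : Set where
  field
    member   : Fin k → SimpleGraph n
    spanning : ∀ i → member i ⊆ᴱ H
    distinct : ∀ i j → ¬ (i ≡ j) → ¬ SameEdges (member i) (member j)
    conn     : ∀ i j → ¬ (i ≡ j) → Connected (symDiff (member i) (member j))

{-# OPTIONS --safe #-}
module Submission where

-- Suppose a connectivity code had 2^t + 1 members. Restricted to the at most t edges of E i,
-- these members show at most 2^t patterns, so two of them, G and G′, agree on E i. There are
-- only (2^t + 1) 2^(t-1) pairs of members, so some i < j share the pair. Then G ⊕ G′ is a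
-- connected spanning subgraph of H avoiding E i ∪ E j, hence H − (E i ∪ E j) is connected.

open import Defs hiding (sym)
open import Data.Bool using (Bool; true; false; _∧_; _∨_; not; _xor_; if_then_else_; T)
open import Data.Bool.Properties using (T-∧; T-∨)
open import Data.Empty using (⊥-elim)
open import Data.Fin as F using (Fin; toℕ; fromℕ<; inject≤; funToFin; finToFun)
open import Data.Fin.Patterns using (0F; 1F)
open import Data.Fin.Properties
  using (2↔Bool; finToFun-funToFin; toℕ-injective; toℕ-fromℕ<; toℕ<n; inject≤-injective; pigeonhole)
  renaming (<-irrefl to <-irreflᶠ)
open import Data.List using (List; []; _∷_; [_]; length; concatMap; lookup; allFin; map)
open import Data.List.Membership.Propositional using (_∈_; lose)
open import Data.List.Membership.Propositional.Properties using (∈-allFin; ∈-concatMap⁺)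
open import Data.List.Properties using (length-++)
open import Data.List.Relation.Unary.Any using (here; index)
open import Data.List.Relation.Unary.Any.Properties using (lookup-index)
open import Data.Nat using (ℕ; zero; suc; z≤n; s≤s; _+_; _*_; _^_; _∸_; _≤_; _<_; _<?_)
open import Data.Nat.Combinatorics using (_C_; nC1≡n; nCk+nC[k+1]≡[n+1]C[k+1])
open import Data.Nat.ListAction using (sum)
open import Data.Nat.Properties
  using (+-comm; +-mono-≤; +-monoˡ-<; +-cancelʳ-≡; *-distribˡ-+; *-cancelˡ-≡; ^-monoʳ-≤;
         ≤-trans; ≤-reflexive; <-≤-trans; <-cmp; <-irrefl; m≤n+m; n<1+n; ≮⇒≥)
open import Data.Nat.Solver using (module +-*-Solver)
open import Data.Product using (_×_; _,_; proj₁; proj₂; ∃₂; uncurry)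
open import Data.Sum using ([_,_]′)
open import Function.Base using (_∘_)
open import Function.Bundles using (Inverse; Equivalence)
open import Relation.Binary.Definitions using (tri<; tri≈; tri>)
open import Relation.Binary.PropositionalEquality
  using (_≡_; _≢_; refl; sym; trans; cong; cong₂; subst; subst₂; module ≡-Reasoning)
open import Relation.Nullary using (¬_; contradiction)
open import Relation.Nullary.Decidable using (⌊_⌋; fromWitness)

private variable
  A B : Set
  a b a′ b′ m n s t : ℕ

Reach-mono : {R S : Adj n} → (∀ u v → T (R u v) → T (S u v)) → ∀ {u v} → Reach R u v → Reach S u v
Reach-mono R⊆S here       = here
Reach-mono R⊆S (step e r) = step (R⊆S _ _ e) (Reach-mono R⊆S r)

Connected-mono : {R S : Adj n} → (∀ u v → T (R u v) → T (S u v)) → Connected R → Connected S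
Connected-mono R⊆S connected u v = Reach-mono R⊆S (connected u v)

record AgreeOn (X G G′ : SimpleGraph n) : Set where
  constructor agreeOn
  field agree : ∀ u v → T (adj X u v) → adj G u v ≡ adj G′ u v

xor⇒∧not : ∀ g g′ {h} c → (T c → g ≡ g′) → (T g → T h) → (T g′ → T h) →
           T (g xor g′) → T (h ∧ not c)
xor⇒∧not true  true  _     _     _  _  ()
xor⇒∧not false false _     _     _  _  ()
xor⇒∧not true  false true  agree _  _  _ = contradiction (agree _) λ ()
xor⇒∧not false true  true  agree _  _  _ = contradiction (agree _) λ ()
xor⇒∧not true  false false _     h  _  _ = Equivalence.from T-∧ (h _ , _)
xor⇒∧not false true  false _     _  h′ _ = Equivalence.from T-∧ (h′ _ , _)

symDiff⊆minusUnion : ∀ {H G G′ X Y : SimpleGraph n} → G ⊆ᴱ H → G′ ⊆ᴱ H →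
                     AgreeOn X G G′ → AgreeOn Y G G′ →
                     ∀ u v → T (symDiff G G′ u v) → T (minusUnion H X Y u v)
symDiff⊆minusUnion {X = X} {Y} G⊆H G′⊆H (agreeOn agreeX) (agreeOn agreeY) u v =
  xor⇒∧not _ _ (adj X u v ∨ adj Y u v) (λ xy → [ agreeX u v , agreeY u v ]′ (Equivalence.to T-∨ xy))
    (G⊆H u v) (G′⊆H u v)

listIf : Bool → A → List A
listIf b x = if b then [ x ] else []

∈-listIf : ∀ {b} {x : A} → T b → x ∈ listIf b x
∈-listIf {b = true} _ = here refl

length-concatMap : (f : A → List B) (g : A → ℕ) → (∀ x → length (f x) ≡ g x) →
                   ∀ xs → length (concatMap f xs) ≡ sum (map g xs)
length-concatMap f g eq []       = refl
length-concatMap f g eq (x ∷ xs) =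
  trans (length-++ (f x)) (cong₂ _+_ (eq x) (length-concatMap f g eq xs))

edgeIf : Bool → SimpleGraph 2
edgeIf b = record { adj = adjacent ; sym = symmetric ; irrefl = λ { 0F → refl ; 1F → refl } }
  where
  adjacent : Fin 2 → Fin 2 → Bool
  adjacent 0F 1F = b
  adjacent 1F 0F = b
  adjacent _  _  = false

  symmetric : ∀ u v → adjacent u v ≡ adjacent v u
  symmetric 0F 0F = refl
  symmetric 0F 1F = refl
  symmetric 1F 0F = refl
  symmetric 1F 1F = refl

-- `edgeCount` sums an indicator Bool → ℕ that is local to its definition and so cannot be
-- named here; `edgeCount (edgeIf b)` unfolds to that indicator at b, plus 0 + 0.
length-listIf : ∀ b (x : A) → length (listIf b x) + 0 + 0 ≡ edgeCount (edgeIf b)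
length-listIf true  _ = refl
length-listIf false _ = refl

ascendingEdge : SimpleGraph n → Fin n → Fin n → Bool
ascendingEdge E u v = ⌊ toℕ u <? toℕ v ⌋ ∧ adj E u v

edgesFrom : SimpleGraph n → Fin n → List (Fin n × Fin n)
edgesFrom {n} E u = concatMap (λ v → listIf (ascendingEdge E u v) (u , v)) (allFin n)

edgeList : SimpleGraph n → List (Fin n × Fin n)
edgeList {n} E = concatMap (edgesFrom E) (allFin n)

length-edgeList : (E : SimpleGraph n) → length (edgeList E) ≡ edgeCount E
length-edgeList {n} E = length-concatMap _ _ (λ u → length-concatMap _ _ (λ v →
  +-cancelʳ-≡ 0 _ _ (+-cancelʳ-≡ 0 _ _ (length-listIf (ascendingEdge E u v) (u , v)))) (allFin n)) (allFin n)

∈-edgeList : ∀ (E : SimpleGraph n) {u v} → toℕ u < toℕ v → T (adj E u v) → (u , v) ∈ edgeList E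
∈-edgeList E {u} {v} u<v uv =
  ∈-concatMap⁺ (edgesFrom E) (lose (∈-allFin u)
    (∈-concatMap⁺ (λ v → listIf (ascendingEdge E u v) (u , v)) (lose (∈-allFin v)
      (∈-listIf (Equivalence.from T-∧ (fromWitness u<v , uv))))))

agreeOn-edgeList : ∀ {E G G′ : SimpleGraph n} →
                   (∀ {u v} → (u , v) ∈ edgeList E → adj G u v ≡ adj G′ u v) →
                   AgreeOn E G G′
agreeOn-edgeList {E = E} {G} {G′} agree = agreeOn agreeOnEdge
  where
  agreeOnEdge : ∀ u v → T (adj E u v) → adj G u v ≡ adj G′ u v
  agreeOnEdge u v uv with <-cmp (toℕ u) (toℕ v)
  ... | tri< u<v _ _ = agree (∈-edgeList E u<v uv)
  ... | tri≈ _ u≡v _ =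
    ⊥-elim (subst T (irrefl E v) (subst (λ w → T (adj E w v)) (toℕ-injective u≡v) uv))
  ... | tri> _ _ v<u = begin
    adj G u v  ≡⟨ SimpleGraph.sym G u v ⟩
    adj G v u  ≡⟨ agree (∈-edgeList E v<u (subst T (SimpleGraph.sym E u v) uv)) ⟩
    adj G′ v u ≡⟨ SimpleGraph.sym G′ v u ⟩
    adj G′ u v ∎
    where open ≡-Reasoning

restriction : SimpleGraph n → (L : List (Fin n × Fin n)) → Fin (length L) → Fin 2
restriction G L i = Inverse.from 2↔Bool (uncurry (adj G) (lookup L i))

restrictionCode : SimpleGraph n → (L : List (Fin n × Fin n)) → Fin (2 ^ length L)
restrictionCode G L = funToFin (restriction G L)

restrictionCode-injective : ∀ {G G′ : SimpleGraph n} L → restrictionCode G L ≡ restrictionCode G′ L →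
                            ∀ {u v} → (u , v) ∈ L → adj G u v ≡ adj G′ u v
restrictionCode-injective {G = G} {G′} L sameCode {u} {v} uv∈L = begin
  adj G u v                                  ≡⟨ cong (uncurry (adj G)) (lookup-index uv∈L) ⟩
  uncurry (adj G) (lookup L i)               ≡⟨ sym (Inverse.strictlyInverseˡ 2↔Bool _) ⟩
  Inverse.to 2↔Bool (restriction G L i)      ≡⟨ cong (Inverse.to 2↔Bool) sameRestriction ⟩
  Inverse.to 2↔Bool (restriction G′ L i)     ≡⟨ Inverse.strictlyInverseˡ 2↔Bool _ ⟩
  uncurry (adj G′) (lookup L i)              ≡⟨ cong (uncurry (adj G′)) (lookup-index uv∈L) ⟨
  adj G′ u v                                 ∎
  where
  open ≡-Reasoning
  i : Fin (length L)
  i = index uv∈L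
  sameRestriction : restriction G L i ≡ restriction G′ L i
  sameRestriction = begin
    restriction G L i                          ≡⟨ finToFun-funToFin (restriction G L) i ⟨
    finToFun (restrictionCode G L) i           ≡⟨ cong (λ c → finToFun c i) sameCode ⟩
    finToFun (restrictionCode G′ L) i          ≡⟨ finToFun-funToFin (restriction G′ L) i ⟩
    restriction G′ L i                         ∎

edgePattern : (E : SimpleGraph n) → edgeCount E ≤ t → SimpleGraph n → Fin (2 ^ t)
edgePattern E |E|≤t G = inject≤ (restrictionCode G (edgeList E))
  (^-monoʳ-≤ 2 (≤-trans (≤-reflexive (length-edgeList E)) |E|≤t))

edgePattern-injective : ∀ {E G G′ : SimpleGraph n} (|E|≤t : edgeCount E ≤ t) →
                        edgePattern E |E|≤t G ≡ edgePattern E |E|≤t G′ → AgreeOn E G G′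
edgePattern-injective {E = E} {G} {G′} |E|≤t samePattern = agreeOn-edgeList
  (restrictionCode-injective {G = G} {G′} (edgeList E) (inject≤-injective _ _ _ _ samePattern))

suc-C2 : ∀ n → suc n C 2 ≡ n + n C 2
suc-C2 n = trans (sym (nCk+nC[k+1]≡[n+1]C[k+1] n 1)) (cong (_+ n C 2) (nC1≡n n))

C2-mono : m ≤ n → m C 2 ≤ n C 2
C2-mono z≤n       = z≤n
C2-mono {suc m} {suc n} (s≤s m≤n) =
  subst₂ _≤_ (sym (suc-C2 m)) (sym (suc-C2 n)) (+-mono-≤ m≤n (C2-mono m≤n))

2*suc[n]C2 : ∀ n → 2 * (suc n C 2) ≡ suc n * n
2*suc[n]C2 zero    = refl
2*suc[n]C2 (suc n) = begin
  2 * (suc (suc n) C 2)   ≡⟨ cong (2 *_) (suc-C2 (suc n)) ⟩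
  2 * (suc n + suc n C 2) ≡⟨ *-distribˡ-+ 2 (suc n) _ ⟩
  2 * suc n + 2 * (suc n C 2) ≡⟨ cong (2 * suc n +_) (2*suc[n]C2 n) ⟩
  2 * suc n + suc n * n   ≡⟨ solve 1 (λ n → con 2 :* (con 1 :+ n) :+ (con 1 :+ n) :* n
                                         := (con 2 :+ n) :* (con 1 :+ n)) refl n ⟩
  suc (suc n) * suc n     ∎
  where open ≡-Reasoning; open +-*-Solver

suc[2n]C2 : ∀ n → suc (2 * n) C 2 ≡ suc (2 * n) * n
suc[2n]C2 n = *-cancelˡ-≡ _ _ 2 (trans (2*suc[n]C2 (2 * n))
  (solve 1 (λ n → (con 1 :+ con 2 :* n) :* (con 2 :* n) := con 2 :* ((con 1 :+ con 2 :* n) :* n)) refl n))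
  where open +-*-Solver

pairIndex : ℕ → ℕ → ℕ
pairIndex a b = a + b C 2

pairIndex-< : a < b → b < m → pairIndex a b < m C 2
pairIndex-< {a} {b} a<b b<m =
  <-≤-trans (subst (a + b C 2 <_) (sym (suc-C2 b)) (+-monoˡ-< (b C 2) a<b)) (C2-mono b<m)

pairIndex-injective : a < b → a′ < b′ → pairIndex a b ≡ pairIndex a′ b′ → a ≡ a′ × b ≡ b′
pairIndex-injective {a} {b} {a′} {b′} a<b a′<b′ eq with <-cmp b b′
... | tri< b<b′ _ _ = ⊥-elim (<-irrefl eq (<-≤-trans (pairIndex-< a<b b<b′) (m≤n+m _ a′)))
... | tri≈ _ refl _ = +-cancelʳ-≡ (b C 2) a a′ eq , refl
... | tri> _ _ b′<b = ⊥-elim (<-irrefl (sym eq) (<-≤-trans (pairIndex-< a′<b′ b′<b) (m≤n+m _ a)))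

pigeonhole-pairs : m C 2 < s → (p : Fin s → Fin m × Fin m) → (∀ i → proj₁ (p i) F.< proj₂ (p i)) →
                   ∃₂ λ i j → i F.< j × p i ≡ p j
pigeonhole-pairs {m} {s} C2<s p ordered =
  let i , j , i<j , sameIndexOf = pigeonhole C2<s indexOf in i , j , i<j , indexOf-injective sameIndexOf
  where
  indexOf : Fin s → Fin (m C 2)
  indexOf i = fromℕ< (pairIndex-< (ordered i) (toℕ<n (proj₂ (p i))))

  indexOf-injective : ∀ {i j} → indexOf i ≡ indexOf j → p i ≡ p j
  indexOf-injective {i} {j} eq =
    let a≡a′ , b≡b′ = pairIndex-injective (ordered i) (ordered j)
                        (trans (sym (toℕ-fromℕ< _)) (trans (cong toℕ eq) (toℕ-fromℕ< _)))
    in cong₂ _,_ (toℕ-injective a≡a′) (toℕ-injective b≡b′)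

module _ {n k t} {H : SimpleGraph n} (code : ConnectivityCode H k) (2ᵗ<k : 2 ^ t < k) where
  open ConnectivityCode code

  private
    Index : Set
    Index = Fin (suc (2 ^ t))

    member′ : Index → SimpleGraph n
    member′ a = member (inject≤ a 2ᵗ<k)

  record AgreeingPair (E : SimpleGraph n) : Set where
    field
      first second : Index
      ordered      : first F.< second
      agreeing     : AgreeOn E (member′ first) (member′ second)

  agreeingPair : ∀ E → edgeCount E ≤ t → AgreeingPair E
  agreeingPair E |E|≤t =
    let a , b , a<b , samePattern = pigeonhole (n<1+n _) (λ a → edgePattern E |E|≤t (member′ a))
    in record { ordered = a<b ; agreeing = edgePattern-injective |E|≤t samePattern }

  agreeingPair⇒connected : ∀ {X Y a b} → a F.< b →
                           AgreeOn X (member′ a) (member′ b) → AgreeOn Y (member′ a) (member′ b) →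
                           Connected (minusUnion H X Y)
  agreeingPair⇒connected {a = a} {b} a<b agreeX agreeY =
    Connected-mono (symDiff⊆minusUnion {H = H} (spanning _) (spanning _) agreeX agreeY) (conn _ _ a≢b)
    where
    a≢b : inject≤ a 2ᵗ<k ≢ inject≤ b 2ᵗ<k
    a≢b eq = <-irreflᶠ (inject≤-injective _ _ a b eq) a<b

  connectedPair : ∀ {s} (E : Fin s → SimpleGraph n) → (∀ i → edgeCount (E i) ≤ t) →
                  suc (2 ^ t) C 2 < s →
                  ∃₂ λ i j → i F.< j × Connected (minusUnion H (E i) (E j))
  connectedPair E |E|≤t C2<s =
    let i , j , i<j , samePair = pigeonhole-pairs C2<s (λ i → first (pair i) , second (pair i))
                                                        (ordered ∘ pair)
        agreeingⱼ : AgreeOn (E j) (member′ (first (pair i))) (member′ (second (pair i)))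
        agreeingⱼ = subst (λ (a , b) → AgreeOn (E j) (member′ a) (member′ b)) (sym samePair)
                          (agreeing (pair j))
    in i , j , i<j , agreeingPair⇒connected (ordered (pair i)) (agreeing (pair i)) agreeingⱼ
    where
    open AgreeingPair
    pair : ∀ i → AgreeingPair (E i)
    pair i = agreeingPair (E i) (|E|≤t i)

lemma3p1 : ∀ {n : ℕ} (H : SimpleGraph n) (t s : ℕ) → 1 ≤ t →
    (E : Fin s → SimpleGraph n) →
    (∀ i → E i ⊆ᴱ H) →
    (∀ i → edgeCount (E i) ≤ t) →
    (∀ i j → toℕ i < toℕ j → ¬ Connected (minusUnion H (E i) (E j))) →
    (2 ^ t + 1) * 2 ^ (t ∸ 1) < s →
    ∀ k → ConnectivityCode H k → k ≤ 2 ^ t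
lemma3p1 H (suc t) s _ E _ |E|≤t disconnected s-large k code = ≮⇒≥ λ 2ᵗ⁺¹<k →
  let i , j , i<j , connected = connectedPair code 2ᵗ⁺¹<k E |E|≤t (subst (_< s) pairCount s-large)
  in disconnected i j i<j connected
  where
  pairCount : (2 ^ suc t + 1) * 2 ^ t ≡ suc (2 ^ suc t) C 2
  pairCount = trans (cong (_* 2 ^ t) (+-comm (2 ^ suc t) 1)) (sym (suc[2n]C2 (2 ^ t)))
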